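{- Let $p\ge 5$ be a prime, $G=GL_2(\mathbb{Z})$, $\Gamma=\Gamma_1(2,p)$ and let $A$ be a torsion element of $\Gamma$. (a) If the eigenvalue $+1$ of $A$ has multiplicity $1$, then the double coset set $\Gamma\backslash N_G^\Gamma(A)/C_G(A)$ has $\frac12(p-1)$ elements. (b) If the eigenvalue $+1$ of $A$ has multiplicity $2$, then $\Gamma\backslash N_G^\Gamma(A)/C_G(A)$ has exactly one element.
   Context: $\Gamma_1(2,p)$ is the subgroup of $GL_2(\mathbb{Z})$ of matrices whose last row is congruent to $(0,1)$ mod $p$. $C_G(A)=\{X\in G: XAX^{ -1}=A\}$ and $N_G^\Gamma(A)=\{X\in G: XAX^{ -1}\in\Gamma\}$; $\Gamma$ acts on $N_G^\Gamma(A)$ by left multiplication and $C_G(A)$ by right multiplication. -}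

module Defs where

open import Data.Nat as ℕ using (ℕ; suc)
open import Data.Integer using (ℤ; +_; -_; _+_; _*_; _-_)
open import Data.Integer.Divisibility using (_∣_)
open import Data.Fin using (Fin)
open import Data.Product using (Σ; ∃; _×_; _,_)
open import Data.Sum using (_⊎_)
open import Relation.Binary.PropositionalEquality using (_≡_; _≢_)
open import Relation.Nullary using (¬_)

record M2 : Set where
  constructor mat
  field
    a b c d : ℤ
open M2 public

infixl 7 _·_
_·_ : M2 → M2 → M2
mat a₁ b₁ c₁ d₁ · mat a₂ b₂ c₂ d₂ =
  mat (a₁ * a₂ + b₁ * c₂) (a₁ * b₂ + b₁ * d₂)
      (c₁ * a₂ + d₁ * c₂) (c₁ * b₂ + d₁ * d₂)

I₂ : M2
I₂ = mat (+ 1) (+ 0) (+ 0) (+ 1)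

det : M2 → ℤ
det (mat a b c d) = a * d - b * c

tr : M2 → ℤ
tr (mat a b c d) = a + d

infixr 8 _^_
_^_ : M2 → ℕ → M2
X ^ ℕ.zero = I₂
X ^ suc n  = X · (X ^ n)

InGL : M2 → Set
InGL X = (det X ≡ + 1) ⊎ (det X ≡ - (+ 1))

-- inverse of an element of GL₂(ℤ):  X⁻¹ = det(X) · adj(X)  (det X = ±1)
inv : M2 → M2
inv X@(mat a b c d) = mat (δ * d) (δ * (- b)) (δ * (- c)) (δ * a)
  where δ = det X

InΓ : ℕ → M2 → Set
InΓ p X = InGL X × ((+ p) ∣ c X) × ((+ p) ∣ (d X - + 1))

Torsion : M2 → Set
Torsion A = ∃ λ n → A ^ suc n ≡ I₂

-- characteristic polynomial x² - tr(A) x + det(A) factors as (x - 1)(x - s)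
-- (i.e. its coefficients agree with x² - (1+s) x + s)
CharFactor : M2 → ℤ → Set
CharFactor A s = (tr A ≡ + 1 + s) × (det A ≡ s)

-- eigenvalue +1 of A has (algebraic) multiplicity exactly 1:
-- χ_A = (x-1)(x-s) with s ≠ 1
EigOneMult1 : M2 → Set
EigOneMult1 A = ∃ λ s → CharFactor A s × (s ≢ + 1)

EigOneMult2 : M2 → Set
EigOneMult2 A = CharFactor A (+ 1)

InC : M2 → M2 → Set
InC A X = InGL X × (X · A · inv X ≡ A)

InN : ℕ → M2 → M2 → Set
InN p A X = InGL X × InΓ p (X · A · inv X)

DCRel : ℕ → M2 → M2 → M2 → Set
DCRel p A X Y = ∃ λ γ → ∃ λ C → InΓ p γ × InC A C × (Y ≡ γ · X · C)

NumDoubleCosets : ℕ → M2 → ℕ → Set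
NumDoubleCosets p A k =
  Σ (Fin k → M2) λ r →
      ((i : Fin k) → InN p A (r i))
    × ((i j : Fin k) → DCRel p A (r i) (r j) → i ≡ j)
    × ((X : M2) → InN p A X → ∃ λ i → DCRel p A (r i) X)

{-# OPTIONS --safe #-}
module Submission where

-- An element A of G whose eigenvalue 1 is simple has det A = −1 and tr A = 0, so A² = I. If C
-- commutes with A then 2C = tr C · I + tr (CA) · A (polarised Cayley–Hamilton applied to CA), and
-- taking determinants, (tr C)² − (tr CA)² = 4 det C = ±4; a parity argument then forces C = ±I or
-- C = ±A.
-- Γ = Γ₁(2,p) consists of the X ∈ G whose last row is (0,1) modulo p, so γX and X have the same
-- last row modulo p for γ ∈ Γ, and X, R ∈ G with the same last row satisfy X R⁻¹ ∈ Γ. Now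
-- XAX⁻¹ ∈ Γ says exactly that A fixes the last row of X modulo p, and as A ≡ (−1 b ; 0 1) this
-- means p ∣ c X (p is odd). Since X (±A) = ±(XAX⁻¹) X, the double coset of X ∈ N_G^Γ(A) is
-- determined by d X modulo p up to sign, a unit modulo p, and the matrices (α β ; p y) ∈ G with
-- 1 ≤ y ≤ (p − 1)/2 represent the double cosets.
-- If 1 is a double eigenvalue then A = I + N with N² = 0, so A^k = I + kN and torsion forces
-- A = I, for which N_G^Γ(I) = C_G(I) = G is a single double coset.

open import Defs
open import Data.Nat using (ℕ; _≤_; _∸_; _/_)
open import Data.Nat.Primality using (Prime)
open import Data.Product using (_×_)

open import Data.Nat as ℕ using (zero; suc; _%_; s≤s; z≤n)
import Data.Nat.Properties as ℕ
import Data.Nat.Divisibility as ℕ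
open import Data.Nat.DivMod using (m≡m%n+[m/n]*n; m%n<n; m*n/n≡m; m<n⇒m%n≡m)
open import Data.Nat.Coprimality as Coprime using (Coprime; coprime-Bézout; prime⇒coprime)
open import Data.Nat.GCD using (module Bézout)
open import Data.Nat.Primality
  using (prime[2]; euclidsLemma; prime⇒nonZero; prime⇒nonTrivial; prime⇒irreducible)
open import Data.Integer as ℤ using (ℤ; +_; -[1+_]; _+_; _*_; -_; _-_; ∣_∣; 0ℤ; 1ℤ; -1ℤ; _%ℕ_; _/ℕ_)
import Data.Integer.Properties as ℤ
open import Data.Integer.DivMod using (a≡a%ℕn+[a/ℕn]*n; n%ℕd<d)
open import Data.Integer.Divisibility.Signed
  using (_∣_; divides; ∣ᵤ⇒∣; ∣⇒∣ᵤ; ∣-refl; ∣m∣n⇒∣m+n; ∣m∣n⇒∣m-n; ∣m⇒∣-m; ∣n⇒∣m*n; ∣m+n∣m⇒∣n; ∣m+n∣n⇒∣m)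
open import Data.Integer.Tactic.RingSolver using (solve-∀)
open import Algebra.Properties.AbelianGroup ℤ.+-0-abelianGroup using () renaming (∙-cancelˡ to +-cancelˡ)
open import Data.Fin as Fin using (Fin; toℕ; fromℕ<)
open import Data.Fin.Properties using (toℕ<n; toℕ-fromℕ<; toℕ-injective)
open import Data.Product using (Σ; ∃; _,_; proj₁; proj₂; map₂)
open import Data.Sum using (_⊎_; inj₁; inj₂)
open import Relation.Nullary using (¬_; yes; no; contradiction)
open import Relation.Binary.Bundles using (Setoid)
open import Relation.Binary.Structures using (IsEquivalence)
import Relation.Binary.Reasoning.Setoid as SetoidReasoning
open import Relation.Binary.PropositionalEquality

IsUnit : ℤ → Set
IsUnit ε = ε ≡ 1ℤ ⊎ ε ≡ -1ℤ

isUnit⇒∣∣≡1 : ∀ {ε} → IsUnit ε → ∣ ε ∣ ≡ 1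
isUnit⇒∣∣≡1 (inj₁ refl) = refl
isUnit⇒∣∣≡1 (inj₂ refl) = refl

∣∣≡1⇒isUnit : ∀ ε → ∣ ε ∣ ≡ 1 → IsUnit ε
∣∣≡1⇒isUnit (+ .1)    refl = inj₁ refl
∣∣≡1⇒isUnit -[1+ .0 ] refl = inj₂ refl

isUnit-* : ∀ {m n} → IsUnit m → IsUnit n → IsUnit (m * n)
isUnit-* (inj₁ refl) (inj₁ refl) = inj₁ refl
isUnit-* (inj₁ refl) (inj₂ refl) = inj₂ refl
isUnit-* (inj₂ refl) (inj₁ refl) = inj₂ refl
isUnit-* (inj₂ refl) (inj₂ refl) = inj₁ refl

isUnit-*⇒isUnit : ∀ m n → IsUnit (m * n) → IsUnit m × IsUnit n
isUnit-*⇒isUnit m n u =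
  ∣∣≡1⇒isUnit m (ℕ.m*n≡1⇒m≡1 ∣ m ∣ ∣ n ∣ ∣mn∣≡1) , ∣∣≡1⇒isUnit n (ℕ.m*n≡1⇒n≡1 ∣ m ∣ ∣ n ∣ ∣mn∣≡1)
  where
  ∣mn∣≡1 : ∣ m ∣ ℕ.* ∣ n ∣ ≡ 1
  ∣mn∣≡1 = trans (sym (ℤ.abs-* m n)) (isUnit⇒∣∣≡1 u)

isUnit⇒square≡1 : ∀ {ε} → IsUnit ε → ε * ε ≡ 1ℤ
isUnit⇒square≡1 (inj₁ refl) = refl
isUnit⇒square≡1 (inj₂ refl) = refl

isUnit⇒*-involutive : ∀ {ε} → IsUnit ε → ∀ x → ε * (ε * x) ≡ x
isUnit⇒*-involutive {ε} u x =
  trans (sym (ℤ.*-assoc ε ε x)) (trans (cong (_* x) (isUnit⇒square≡1 u)) (ℤ.*-identityˡ x))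

2∣m*n⇒2∣m∨2∣n : ∀ m n → + 2 ∣ m * n → (+ 2 ∣ m) ⊎ (+ 2 ∣ n)
2∣m*n⇒2∣m∨2∣n m n 2∣mn with euclidsLemma ∣ m ∣ ∣ n ∣ prime[2] (subst (2 ℕ.∣_) (ℤ.abs-* m n) (∣⇒∣ᵤ 2∣mn))
... | inj₁ 2∣m = inj₁ (∣ᵤ⇒∣ 2∣m)
... | inj₂ 2∣n = inj₂ (∣ᵤ⇒∣ 2∣n)

even-factors : ∀ m n → + 2 ∣ m + n → + 2 ∣ m * n → (+ 2 ∣ m) × (+ 2 ∣ n)
even-factors m n 2∣m+n 2∣mn with 2∣m*n⇒2∣m∨2∣n m n 2∣mn
... | inj₁ 2∣m = 2∣m , ∣m+n∣m⇒∣n 2∣m+n 2∣m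
... | inj₂ 2∣n = ∣m+n∣n⇒∣m 2∣m+n 2∣n , 2∣n

difference-of-squares≡±4⇒units : ∀ t u {ε} → IsUnit ε → (t + u) * (t - u) ≡ + 4 * ε →
  Σ ℤ λ μ → Σ ℤ λ ν → (IsUnit μ × IsUnit ν) × t ≡ μ + ν × u ≡ μ - ν
difference-of-squares≡±4⇒units t u {ε} uε eq =
  halves (even-factors (t + u) (t - u) (divides t (sum t u)) (divides (+ 2 * ε) (trans eq (four ε))))
  where
  open ≡-Reasoning
  sum : ∀ t u → (t + u) + (t - u) ≡ t * + 2
  sum = solve-∀
  four : ∀ ε → + 4 * ε ≡ (+ 2 * ε) * + 2
  four = solve-∀
  halves : (+ 2 ∣ t + u) × (+ 2 ∣ t - u) →
    Σ ℤ λ μ → Σ ℤ λ ν → (IsUnit μ × IsUnit ν) × t ≡ μ + ν × u ≡ μ - ν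
  halves (divides μ t+u≡2μ , divides ν t-u≡2ν) =
    μ , ν , isUnit-*⇒isUnit μ ν (subst IsUnit (sym μν≡ε) uε) , t≡μ+ν , u≡μ-ν
    where
    μν≡ε : μ * ν ≡ ε
    μν≡ε = ℤ.*-cancelˡ-≡ (+ 4) (μ * ν) ε (begin
      + 4 * (μ * ν)             ≡⟨ product μ ν ⟩
      (μ * + 2) * (ν * + 2)     ≡⟨ cong₂ _*_ t+u≡2μ t-u≡2ν ⟨
      (t + u) * (t - u)         ≡⟨ eq ⟩
      + 4 * ε                   ∎)
      where
      product : ∀ μ ν → + 4 * (μ * ν) ≡ (μ * + 2) * (ν * + 2)
      product = solve-∀
    t≡μ+ν : t ≡ μ + ν
    t≡μ+ν = ℤ.*-cancelʳ-≡ t (μ + ν) (+ 2) (begin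
      t * + 2                   ≡⟨ sum t u ⟨
      (t + u) + (t - u)         ≡⟨ cong₂ _+_ t+u≡2μ t-u≡2ν ⟩
      μ * + 2 + ν * + 2         ≡⟨ ℤ.*-distribʳ-+ (+ 2) μ ν ⟨
      (μ + ν) * + 2             ∎)
    u≡μ-ν : u ≡ μ - ν
    u≡μ-ν = ℤ.*-cancelʳ-≡ u (μ - ν) (+ 2) (begin
      u * + 2                   ≡⟨ difference t u ⟩
      (t + u) - (t - u)         ≡⟨ cong₂ _-_ t+u≡2μ t-u≡2ν ⟩
      μ * + 2 - ν * + 2         ≡⟨ difference-scaled μ ν ⟨
      (μ - ν) * + 2             ∎)
      where
      difference : ∀ t u → u * + 2 ≡ (t + u) - (t - u)
      difference = solve-∀
      difference-scaled : ∀ μ ν → (μ - ν) * + 2 ≡ μ * + 2 - ν * + 2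
      difference-scaled = solve-∀

difference-of-squares≡±4 : ∀ t u {ε} → IsUnit ε → (t + u) * (t - u) ≡ + 4 * ε →
  Σ ℤ λ η → IsUnit η × ((t ≡ η + η × u ≡ 0ℤ) ⊎ (t ≡ 0ℤ × u ≡ η + η))
difference-of-squares≡±4 t u uε eq = solutions (difference-of-squares≡±4⇒units t u uε eq)
  where
  solutions : (Σ ℤ λ μ → Σ ℤ λ ν → (IsUnit μ × IsUnit ν) × t ≡ μ + ν × u ≡ μ - ν) →
    Σ ℤ λ η → IsUnit η × ((t ≡ η + η × u ≡ 0ℤ) ⊎ (t ≡ 0ℤ × u ≡ η + η))
  solutions (μ , ν , (inj₁ refl , inj₁ refl) , t≡2 , u≡0) = 1ℤ , inj₁ refl , inj₁ (t≡2 , u≡0)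
  solutions (μ , ν , (inj₂ refl , inj₂ refl) , t≡-2 , u≡0) = -1ℤ , inj₂ refl , inj₁ (t≡-2 , u≡0)
  solutions (μ , ν , (inj₁ refl , inj₂ refl) , t≡0 , u≡2) = 1ℤ , inj₁ refl , inj₂ (t≡0 , u≡2)
  solutions (μ , ν , (inj₂ refl , inj₁ refl) , t≡0 , u≡-2) = -1ℤ , inj₂ refl , inj₂ (t≡0 , u≡-2)

module Congruence (n : ℤ) where

  infix 4 _≈_
  record _≈_ (x y : ℤ) : Set where
    constructor congruent
    field divides-difference : n ∣ x - y

  ≈-reflexive : ∀ {x y} → x ≡ y → x ≈ y
  ≈-reflexive {x} refl = congruent (divides 0ℤ (ℤ.+-inverseʳ x))

  ≈-refl : ∀ {x} → x ≈ x
  ≈-refl = ≈-reflexive refl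

  ≈-sym : ∀ {x y} → x ≈ y → y ≈ x
  ≈-sym {x} {y} (congruent x≈y) = congruent (subst (n ∣_) (swap x y) (∣m⇒∣-m x≈y))
    where
    swap : ∀ x y → - (x - y) ≡ y - x
    swap = solve-∀

  ≈-trans : ∀ {x y z} → x ≈ y → y ≈ z → x ≈ z
  ≈-trans {x} {y} {z} (congruent x≈y) (congruent y≈z) =
    congruent (subst (n ∣_) (telescope x y z) (∣m∣n⇒∣m+n x≈y y≈z))
    where
    telescope : ∀ x y z → (x - y) + (y - z) ≡ x - z
    telescope = solve-∀

  ≈-isEquivalence : IsEquivalence _≈_
  ≈-isEquivalence = record { refl = ≈-refl ; sym = ≈-sym ; trans = ≈-trans }

  ≈-setoid : Setoid _ _
  ≈-setoid = record { isEquivalence = ≈-isEquivalence }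

  module ≈-Reasoning = SetoidReasoning ≈-setoid

  +-cong : ∀ {x y u v} → x ≈ y → u ≈ v → x + u ≈ y + v
  +-cong {x} {y} {u} {v} (congruent x≈y) (congruent u≈v) =
    congruent (subst (n ∣_) (rearrange x y u v) (∣m∣n⇒∣m+n x≈y u≈v))
    where
    rearrange : ∀ x y u v → (x - y) + (u - v) ≡ (x + u) - (y + v)
    rearrange = solve-∀

  neg-cong : ∀ {x y} → x ≈ y → - x ≈ - y
  neg-cong {x} {y} (congruent x≈y) = congruent (subst (n ∣_) (rearrange x y) (∣m⇒∣-m x≈y))
    where
    rearrange : ∀ x y → - (x - y) ≡ - x - - y
    rearrange = solve-∀

  *-cong : ∀ {x y u v} → x ≈ y → u ≈ v → x * u ≈ y * v
  *-cong {x} {y} {u} {v} (congruent x≈y) (congruent u≈v) =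
    congruent (subst (n ∣_) (rearrange x y u v) (∣m∣n⇒∣m+n (∣n⇒∣m*n x u≈v) (∣n⇒∣m*n v x≈y)))
    where
    rearrange : ∀ x y u v → x * (u - v) + v * (x - y) ≡ x * u - y * v
    rearrange = solve-∀

  ∣⇒≈0 : ∀ {x} → n ∣ x → x ≈ 0ℤ
  ∣⇒≈0 {x} n∣x = congruent (subst (n ∣_) (sym (ℤ.+-identityʳ x)) n∣x)

  ≈0⇒∣ : ∀ {x} → x ≈ 0ℤ → n ∣ x
  ≈0⇒∣ {x} (congruent n∣x) = subst (n ∣_) (ℤ.+-identityʳ x) n∣x

  n≈0 : n ≈ 0ℤ
  n≈0 = ∣⇒≈0 ∣-refl

  -- 1 + h inverts 2 modulo 1 + 2h.
  ≈-neg⇒≈0 : ∀ h → n ≡ 1ℤ + + 2 * + h → ∀ {x} → x ≈ - x → x ≈ 0ℤ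
  ≈-neg⇒≈0 h n≡1+2h {x} (congruent n∣x+x) =
    ∣⇒≈0 (subst (n ∣_) (halve x) (∣m∣n⇒∣m-n (∣n⇒∣m*n (1ℤ + + h) n∣x+x) (∣n⇒∣m*n x ∣-refl)))
    where
    halve : ∀ x → (1ℤ + + h) * (x - - x) - x * n ≡ x
    halve x = trans (cong (λ m → (1ℤ + + h) * (x - - x) - x * m) n≡1+2h) (identity x (+ h))
      where
      identity : ∀ x h → (1ℤ + h) * (x - - x) - x * (1ℤ + + 2 * h) ≡ x
      identity = solve-∀

mat-cong : ∀ {a₁ b₁ c₁ d₁ a₂ b₂ c₂ d₂} →
  a₁ ≡ a₂ → b₁ ≡ b₂ → c₁ ≡ c₂ → d₁ ≡ d₂ → mat a₁ b₁ c₁ d₁ ≡ mat a₂ b₂ c₂ d₂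
mat-cong refl refl refl refl = refl

infixl 6 _⊕_
_⊕_ : M2 → M2 → M2
mat a₁ b₁ c₁ d₁ ⊕ mat a₂ b₂ c₂ d₂ = mat (a₁ + a₂) (b₁ + b₂) (c₁ + c₂) (d₁ + d₂)

infixr 8 _⊙_
_⊙_ : ℤ → M2 → M2
k ⊙ mat a b c d = mat (k * a) (k * b) (k * c) (k * d)

·-assoc : ∀ X Y Z → X · Y · Z ≡ X · (Y · Z)
·-assoc (mat x₁ x₂ x₃ x₄) (mat y₁ y₂ y₃ y₄) (mat z₁ z₂ z₃ z₄) =
  mat-cong (entry y₁ y₂ y₃ y₄ x₁ x₂ z₁ z₃) (entry y₁ y₂ y₃ y₄ x₁ x₂ z₂ z₄)
           (entry y₁ y₂ y₃ y₄ x₃ x₄ z₁ z₃) (entry y₁ y₂ y₃ y₄ x₃ x₄ z₂ z₄)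
  where
  entry : ∀ y₁ y₂ y₃ y₄ r s u v →
    (r * y₁ + s * y₃) * u + (r * y₂ + s * y₄) * v ≡ r * (y₁ * u + y₂ * v) + s * (y₃ * u + y₄ * v)
  entry = solve-∀

·-identityˡ : ∀ X → I₂ · X ≡ X
·-identityˡ (mat a b c d) = mat-cong (first a c) (first b d) (second a c) (second b d)
  where
  first : ∀ x y → + 1 * x + + 0 * y ≡ x
  first = solve-∀
  second : ∀ x y → + 0 * x + + 1 * y ≡ y
  second = solve-∀

·-identityʳ : ∀ X → X · I₂ ≡ X
·-identityʳ (mat a b c d) = mat-cong (first a b) (second a b) (first c d) (second c d)
  where
  first : ∀ x y → x * + 1 + y * + 0 ≡ x
  first = solve-∀
  second : ∀ x y → x * + 0 + y * + 1 ≡ y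
  second = solve-∀

·-⊙ʳ : ∀ k X Y → X · (k ⊙ Y) ≡ k ⊙ (X · Y)
·-⊙ʳ k (mat x₁ x₂ x₃ x₄) (mat y₁ y₂ y₃ y₄) =
  mat-cong (entry k x₁ x₂ y₁ y₃) (entry k x₁ x₂ y₂ y₄) (entry k x₃ x₄ y₁ y₃) (entry k x₃ x₄ y₂ y₄)
  where
  entry : ∀ k r s u v → r * (k * u) + s * (k * v) ≡ k * (r * u + s * v)
  entry = solve-∀

·-⊙I₂ : ∀ k X → X · (k ⊙ I₂) ≡ k ⊙ X
·-⊙I₂ k X = trans (·-⊙ʳ k X I₂) (cong (k ⊙_) (·-identityʳ X))

⊙I₂-· : ∀ k X → (k ⊙ I₂) · X ≡ k ⊙ X
⊙I₂-· k (mat a b c d) = mat-cong (first k a c) (first k b d) (second k a c) (second k b d)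
  where
  first : ∀ k x y → (k * + 1) * x + (k * + 0) * y ≡ k * x
  first = solve-∀
  second : ∀ k x y → (k * + 0) * x + (k * + 1) * y ≡ k * y
  second = solve-∀

⊙-⊕-double : ∀ k X → (k + k) ⊙ X ≡ k ⊙ X ⊕ k ⊙ X
⊙-⊕-double k (mat a b c d) = mat-cong (distrib a) (distrib b) (distrib c) (distrib d)
  where
  distrib : ∀ x → (k + k) * x ≡ k * x + k * x
  distrib x = ℤ.*-distribʳ-+ x k k

O₂ : M2
O₂ = mat 0ℤ 0ℤ 0ℤ 0ℤ

⊕-identityˡ : ∀ X → O₂ ⊕ X ≡ X
⊕-identityˡ (mat a b c d) =
  mat-cong (ℤ.+-identityˡ a) (ℤ.+-identityˡ b) (ℤ.+-identityˡ c) (ℤ.+-identityˡ d)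

⊕-identityʳ : ∀ X → X ⊕ O₂ ≡ X
⊕-identityʳ (mat a b c d) =
  mat-cong (ℤ.+-identityʳ a) (ℤ.+-identityʳ b) (ℤ.+-identityʳ c) (ℤ.+-identityʳ d)

⊙-O₂ : ∀ k → k ⊙ O₂ ≡ O₂
⊙-O₂ k = mat-cong (ℤ.*-zeroʳ k) (ℤ.*-zeroʳ k) (ℤ.*-zeroʳ k) (ℤ.*-zeroʳ k)

⊕-cancelˡ : ∀ X Y Z → X ⊕ Y ≡ X ⊕ Z → Y ≡ Z
⊕-cancelˡ (mat a b c d) Y Z eq =
  mat-cong (+-cancelˡ a _ _ (cong M2.a eq)) (+-cancelˡ b _ _ (cong M2.b eq))
           (+-cancelˡ c _ _ (cong M2.c eq)) (+-cancelˡ d _ _ (cong M2.d eq))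

[1+n]⊙X≡O₂⇒X≡O₂ : ∀ n X → (+ suc n) ⊙ X ≡ O₂ → X ≡ O₂
[1+n]⊙X≡O₂⇒X≡O₂ n (mat a b c d) eq =
  mat-cong (cancel (cong M2.a eq)) (cancel (cong M2.b eq))
           (cancel (cong M2.c eq)) (cancel (cong M2.d eq))
  where
  cancel : ∀ {x} → + suc n * x ≡ 0ℤ → x ≡ 0ℤ
  cancel {x} eq with ℤ.i*j≡0⇒i≡0∨j≡0 (+ suc n) eq
  ... | inj₂ x≡0 = x≡0

⊕-double-injective : ∀ {X Y} → X ⊕ X ≡ Y ⊕ Y → X ≡ Y
⊕-double-injective {mat a₁ b₁ c₁ d₁} {mat a₂ b₂ c₂ d₂} eq =
  mat-cong (halve (cong a eq)) (halve (cong b eq)) (halve (cong c eq)) (halve (cong d eq))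
  where
  halve : ∀ {x y} → x + x ≡ y + y → x ≡ y
  halve {x} {y} x+x≡y+y = ℤ.*-cancelˡ-≡ (+ 2) x y (trans (double x) (trans x+x≡y+y (sym (double y))))
    where
    double : ∀ x → + 2 * x ≡ x + x
    double = solve-∀

det-· : ∀ X Y → det (X · Y) ≡ det X * det Y
det-· (mat x₁ x₂ x₃ x₄) (mat y₁ y₂ y₃ y₄) = multiplicative x₁ x₂ x₃ x₄ y₁ y₂ y₃ y₄
  where
  multiplicative : ∀ x₁ x₂ x₃ x₄ y₁ y₂ y₃ y₄ →
    (x₁ * y₁ + x₂ * y₃) * (x₃ * y₂ + x₄ * y₄) - (x₁ * y₂ + x₂ * y₄) * (x₃ * y₁ + x₄ * y₃)
    ≡ (x₁ * x₄ - x₂ * x₃) * (y₁ * y₄ - y₂ * y₃)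
  multiplicative = solve-∀

det-⊕-double : ∀ X → det (X ⊕ X) ≡ + 4 * det X
det-⊕-double (mat a b c d) = quadratic a b c d
  where
  quadratic : ∀ a b c d → (a + a) * (d + d) - (b + b) * (c + c) ≡ + 4 * (a * d - b * c)
  quadratic = solve-∀

·-inv : ∀ X → X · inv X ≡ (det X * det X) ⊙ I₂
·-inv (mat a b c d) = mat-cong (e₁₁ a b c d) (e₁₂ a b c d) (e₂₁ a b c d) (e₂₂ a b c d)
  where
  e₁₁ : ∀ a b c d → let δ = a * d - b * c in a * (δ * d) + b * (δ * - c) ≡ (δ * δ) * + 1
  e₁₁ = solve-∀
  e₁₂ : ∀ a b c d → let δ = a * d - b * c in a * (δ * - b) + b * (δ * a) ≡ (δ * δ) * + 0
  e₁₂ = solve-∀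
  e₂₁ : ∀ a b c d → let δ = a * d - b * c in c * (δ * d) + d * (δ * - c) ≡ (δ * δ) * + 0
  e₂₁ = solve-∀
  e₂₂ : ∀ a b c d → let δ = a * d - b * c in c * (δ * - b) + d * (δ * a) ≡ (δ * δ) * + 1
  e₂₂ = solve-∀

inv-· : ∀ X → inv X · X ≡ (det X * det X) ⊙ I₂
inv-· (mat a b c d) = mat-cong (e₁₁ a b c d) (e₁₂ a b c d) (e₂₁ a b c d) (e₂₂ a b c d)
  where
  e₁₁ : ∀ a b c d → let δ = a * d - b * c in (δ * d) * a + (δ * - b) * c ≡ (δ * δ) * + 1
  e₁₁ = solve-∀
  e₁₂ : ∀ a b c d → let δ = a * d - b * c in (δ * d) * b + (δ * - b) * d ≡ (δ * δ) * + 0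
  e₁₂ = solve-∀
  e₂₁ : ∀ a b c d → let δ = a * d - b * c in (δ * - c) * a + (δ * a) * c ≡ (δ * δ) * + 0
  e₂₁ = solve-∀
  e₂₂ : ∀ a b c d → let δ = a * d - b * c in (δ * - c) * b + (δ * a) * d ≡ (δ * δ) * + 1
  e₂₂ = solve-∀

inv-inverseʳ : ∀ X → InGL X → X · inv X ≡ I₂
inv-inverseʳ X g = trans (·-inv X) (cong (_⊙ I₂) (isUnit⇒square≡1 g))

inv-inverseˡ : ∀ X → InGL X → inv X · X ≡ I₂
inv-inverseˡ X g = trans (inv-· X) (cong (_⊙ I₂) (isUnit⇒square≡1 g))

y·x⁻¹·x≡y : ∀ X → InGL X → ∀ Y → Y · inv X · X ≡ Y
y·x⁻¹·x≡y X g Y = trans (·-assoc Y (inv X) X) (trans (cong (Y ·_) (inv-inverseˡ X g)) (·-identityʳ Y))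

y·x·x⁻¹≡y : ∀ X → InGL X → ∀ Y → Y · X · inv X ≡ Y
y·x·x⁻¹≡y X g Y = trans (·-assoc Y X (inv X)) (trans (cong (Y ·_) (inv-inverseʳ X g)) (·-identityʳ Y))

InGL-· : ∀ X Y → InGL X → InGL Y → InGL (X · Y)
InGL-· X Y gX gY = subst IsUnit (sym (det-· X Y)) (isUnit-* gX gY)

InGL-inv : ∀ X → InGL X → InGL (inv X)
InGL-inv X g = proj₁ (isUnit-*⇒isUnit (det (inv X)) (det X) (subst IsUnit det-inv·X (inj₁ refl)))
  where
  det-inv·X : 1ℤ ≡ det (inv X) * det X
  det-inv·X = trans (cong det (sym (inv-inverseˡ X g))) (det-· (inv X) X)

InGL-unit-scalar : ∀ {ε} → IsUnit ε → InGL (ε ⊙ I₂)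
InGL-unit-scalar (inj₁ refl) = inj₁ refl
InGL-unit-scalar (inj₂ refl) = inj₁ refl

unit-scalar-involutive : ∀ {ε} → IsUnit ε → (ε ⊙ I₂) · (ε ⊙ I₂) ≡ I₂
unit-scalar-involutive (inj₁ refl) = refl
unit-scalar-involutive (inj₂ refl) = refl

IsReflection : M2 → Set
IsReflection A = tr A ≡ 0ℤ × det A ≡ -1ℤ

simple-eigenvalue-one⇒reflection : ∀ A → InGL A → EigOneMult1 A → IsReflection A
simple-eigenvalue-one⇒reflection A (inj₁ det≡1) (s , (tr≡1+s , det≡s) , s≢1) =
  contradiction (trans (sym det≡s) det≡1) s≢1
simple-eigenvalue-one⇒reflection A (inj₂ det≡-1) (s , (tr≡1+s , det≡s) , s≢1) =
  trans tr≡1+s (cong (_+_ 1ℤ) (trans (sym det≡s) det≡-1)) , det≡-1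

a+d≡0⇒d≡-a : ∀ a d → a + d ≡ 0ℤ → d ≡ - a
a+d≡0⇒d≡-a a d a+d≡0 = begin
  d             ≡⟨ cancel a d ⟩
  (a + d) - a   ≡⟨ cong (_- a) a+d≡0 ⟩
  0ℤ - a        ≡⟨ ℤ.+-identityˡ (- a) ⟩
  - a           ∎
  where
  open ≡-Reasoning
  cancel : ∀ a d → d ≡ (a + d) - a
  cancel = solve-∀

traceless-square : ∀ A → tr A ≡ 0ℤ → A · A ≡ (- det A) ⊙ I₂
traceless-square (mat a b c d) a+d≡0 with a+d≡0⇒d≡-a a d a+d≡0
... | refl =
  mat-cong (e₁₁ a b c) (e₁₂ a b c) (e₂₁ a b c) (e₂₂ a b c)
  where
  e₁₁ : ∀ a b c → a * a + b * c ≡ - (a * - a - b * c) * + 1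
  e₁₁ = solve-∀
  e₁₂ : ∀ a b c → a * b + b * - a ≡ - (a * - a - b * c) * + 0
  e₁₂ = solve-∀
  e₂₁ : ∀ a b c → c * a + - a * c ≡ - (a * - a - b * c) * + 0
  e₂₁ = solve-∀
  e₂₂ : ∀ a b c → c * b + - a * - a ≡ - (a * - a - b * c) * + 1
  e₂₂ = solve-∀

polarisation : ∀ X A → tr A ≡ 0ℤ → X · A ⊕ A · X ≡ tr (X · A) ⊙ I₂ ⊕ tr X ⊙ A
polarisation (mat x y z w) (mat a b c d) a+d≡0 with a+d≡0⇒d≡-a a d a+d≡0
... | refl =
  mat-cong (e₁₁ x y z w a b c) (e₁₂ x y z w a b c) (e₂₁ x y z w a b c) (e₂₂ x y z w a b c)
  where
  e₁₁ : ∀ x y z w a b c →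
    (x * a + y * c) + (a * x + b * z) ≡ ((x * a + y * c) + (z * b + w * - a)) * + 1 + (x + w) * a
  e₁₁ = solve-∀
  e₁₂ : ∀ x y z w a b c →
    (x * b + y * - a) + (a * y + b * w) ≡ ((x * a + y * c) + (z * b + w * - a)) * + 0 + (x + w) * b
  e₁₂ = solve-∀
  e₂₁ : ∀ x y z w a b c →
    (z * a + w * c) + (c * x + - a * z) ≡ ((x * a + y * c) + (z * b + w * - a)) * + 0 + (x + w) * c
  e₂₁ = solve-∀
  e₂₂ : ∀ x y z w a b c →
    (z * b + w * - a) + (c * y + - a * w) ≡ ((x * a + y * c) + (z * b + w * - a)) * + 1 + (x + w) * - a
  e₂₂ = solve-∀

det-pencil : ∀ A → tr A ≡ 0ℤ → ∀ t u → det (t ⊙ I₂ ⊕ u ⊙ A) ≡ t * t + det A * (u * u)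
det-pencil (mat a b c d) a+d≡0 t u with a+d≡0⇒d≡-a a d a+d≡0
... | refl = quadratic t u a b c
  where
  quadratic : ∀ t u a b c →
    (t * + 1 + u * a) * (t * + 1 + u * - a) - (t * + 0 + u * b) * (t * + 0 + u * c)
    ≡ t * t + (a * - a - b * c) * (u * u)
  quadratic = solve-∀

InC⇒commute : ∀ A C → InC A C → C · A ≡ A · C
InC⇒commute A C (gC , CAC⁻¹≡A) = trans (sym (y·x⁻¹·x≡y C gC (C · A))) (cong (_· C) CAC⁻¹≡A)

commuting⇒InC : ∀ A C → InGL C → C · A ≡ A · C → InC A C
commuting⇒InC A C gC CA≡AC = gC , trans (cong (_· inv C) CA≡AC) (y·x·x⁻¹≡y C gC A)

unit-scalar∈C : ∀ A {ε} → IsUnit ε → InC A (ε ⊙ I₂)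
unit-scalar∈C A {ε} uε =
  commuting⇒InC A (ε ⊙ I₂) (InGL-unit-scalar uε) (trans (⊙I₂-· ε A) (sym (·-⊙I₂ ε A)))

reflection-involutive : ∀ A → IsReflection A → A · A ≡ I₂
reflection-involutive A (tr≡0 , det≡-1) =
  trans (traceless-square A tr≡0) (cong (λ δ → (- δ) ⊙ I₂) det≡-1)

centralizer-decomposition : ∀ A C → IsReflection A → C · A ≡ A · C →
  C ⊕ C ≡ tr C ⊙ I₂ ⊕ tr (C · A) ⊙ A
centralizer-decomposition A C isRefl@(tr≡0 , _) CA≡AC = begin
  C ⊕ C                                   ≡⟨ cong₂ _⊕_ CAA≡C ACA≡C ⟨
  C · A · A ⊕ A · (C · A)                 ≡⟨ polarisation (C · A) A tr≡0 ⟩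
  tr (C · A · A) ⊙ I₂ ⊕ tr (C · A) ⊙ A    ≡⟨ cong (λ Y → tr Y ⊙ I₂ ⊕ tr (C · A) ⊙ A) CAA≡C ⟩
  tr C ⊙ I₂ ⊕ tr (C · A) ⊙ A              ∎
  where
  open ≡-Reasoning
  CAA≡C : C · A · A ≡ C
  CAA≡C = trans (·-assoc C A A) (trans (cong (C ·_) (reflection-involutive A isRefl)) (·-identityʳ C))
  ACA≡C : A · (C · A) ≡ C
  ACA≡C = trans (sym (·-assoc A C A)) (trans (cong (_· A) (sym CA≡AC)) CAA≡C)

trace-squares : ∀ A C → IsReflection A → InC A C →
  (tr C + tr (C · A)) * (tr C - tr (C · A)) ≡ + 4 * det C
trace-squares A C isRefl@(tr≡0 , det≡-1) inC = begin
  (t + u) * (t - u)              ≡⟨ difference t u ⟩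
  t * t + -1ℤ * (u * u)          ≡⟨ cong (λ δ → t * t + δ * (u * u)) det≡-1 ⟨
  t * t + det A * (u * u)        ≡⟨ det-pencil A tr≡0 t u ⟨
  det (t ⊙ I₂ ⊕ u ⊙ A)           ≡⟨ cong det (centralizer-decomposition A C isRefl (InC⇒commute A C inC)) ⟨
  det (C ⊕ C)                    ≡⟨ det-⊕-double C ⟩
  + 4 * det C                    ∎
  where
  open ≡-Reasoning
  t u : ℤ
  t = tr C
  u = tr (C · A)
  difference : ∀ t u → (t + u) * (t - u) ≡ t * t + -1ℤ * (u * u)
  difference = solve-∀

centralizer-of-reflection : ∀ A C → IsReflection A → InC A C →
  Σ ℤ λ ε → IsUnit ε × (C ≡ ε ⊙ I₂ ⊎ C ≡ ε ⊙ A)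
centralizer-of-reflection A C isRefl inC@(gC , _) =
  classify (difference-of-squares≡±4 (tr C) (tr (C · A)) gC (trace-squares A C isRefl inC))
  where
  open ≡-Reasoning
  decomposition : C ⊕ C ≡ tr C ⊙ I₂ ⊕ tr (C · A) ⊙ A
  decomposition = centralizer-decomposition A C isRefl (InC⇒commute A C inC)
  classify :
    Σ ℤ (λ η → IsUnit η × ((tr C ≡ η + η × tr (C · A) ≡ 0ℤ) ⊎ (tr C ≡ 0ℤ × tr (C · A) ≡ η + η))) →
    Σ ℤ λ ε → IsUnit ε × (C ≡ ε ⊙ I₂ ⊎ C ≡ ε ⊙ A)
  classify (η , uη , inj₁ (t≡η+η , u≡0)) = η , uη , inj₁ (⊕-double-injective (begin
    C ⊕ C                              ≡⟨ decomposition ⟩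
    tr C ⊙ I₂ ⊕ tr (C · A) ⊙ A         ≡⟨ cong₂ (λ t u → t ⊙ I₂ ⊕ u ⊙ A) t≡η+η u≡0 ⟩
    (η + η) ⊙ I₂ ⊕ O₂                  ≡⟨ ⊕-identityʳ ((η + η) ⊙ I₂) ⟩
    (η + η) ⊙ I₂                       ≡⟨ ⊙-⊕-double η I₂ ⟩
    η ⊙ I₂ ⊕ η ⊙ I₂                    ∎))
  classify (η , uη , inj₂ (t≡0 , u≡η+η)) = η , uη , inj₂ (⊕-double-injective (begin
    C ⊕ C                              ≡⟨ decomposition ⟩
    tr C ⊙ I₂ ⊕ tr (C · A) ⊙ A         ≡⟨ cong₂ (λ t u → t ⊙ I₂ ⊕ u ⊙ A) t≡0 u≡η+η ⟩
    O₂ ⊕ (η + η) ⊙ A                   ≡⟨ ⊕-identityˡ ((η + η) ⊙ A) ⟩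
    (η + η) ⊙ A                        ≡⟨ ⊙-⊕-double η A ⟩
    η ⊙ A ⊕ η ⊙ A                      ∎))

expand-[I₂⊕N]·[I₂⊕k⊙N] : ∀ k N → (I₂ ⊕ N) · (I₂ ⊕ k ⊙ N) ≡ I₂ ⊕ (1ℤ + k) ⊙ N ⊕ k ⊙ (N · N)
expand-[I₂⊕N]·[I₂⊕k⊙N] k (mat a b c d) =
  mat-cong (e₁₁ k a b c d) (e₁₂ k a b c d) (e₂₁ k a b c d) (e₂₂ k a b c d)
  where
  e₁₁ : ∀ k a b c d → (+ 1 + a) * (+ 1 + k * a) + (+ 0 + b) * (+ 0 + k * c)
                    ≡ + 1 + (+ 1 + k) * a + k * (a * a + b * c)
  e₁₁ = solve-∀
  e₁₂ : ∀ k a b c d → (+ 1 + a) * (+ 0 + k * b) + (+ 0 + b) * (+ 1 + k * d)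
                    ≡ + 0 + (+ 1 + k) * b + k * (a * b + b * d)
  e₁₂ = solve-∀
  e₂₁ : ∀ k a b c d → (+ 0 + c) * (+ 1 + k * a) + (+ 1 + d) * (+ 0 + k * c)
                    ≡ + 0 + (+ 1 + k) * c + k * (c * a + d * c)
  e₂₁ = solve-∀
  e₂₂ : ∀ k a b c d → (+ 0 + c) * (+ 0 + k * b) + (+ 1 + d) * (+ 1 + k * d)
                    ≡ + 1 + (+ 1 + k) * d + k * (c * b + d * d)
  e₂₂ = solve-∀

unipotent-power : ∀ N → tr N ≡ 0ℤ → det N ≡ 0ℤ → ∀ k → (I₂ ⊕ N) ^ k ≡ I₂ ⊕ (+ k) ⊙ N
unipotent-power N tr≡0 det≡0 zero = refl
unipotent-power N tr≡0 det≡0 (suc k) = begin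
  (I₂ ⊕ N) · (I₂ ⊕ N) ^ k                  ≡⟨ cong ((I₂ ⊕ N) ·_) (unipotent-power N tr≡0 det≡0 k) ⟩
  (I₂ ⊕ N) · (I₂ ⊕ (+ k) ⊙ N)              ≡⟨ expand-[I₂⊕N]·[I₂⊕k⊙N] (+ k) N ⟩
  I₂ ⊕ (+ suc k) ⊙ N ⊕ (+ k) ⊙ (N · N)     ≡⟨ cong (λ M → I₂ ⊕ (+ suc k) ⊙ N ⊕ (+ k) ⊙ M) N·N≡O₂ ⟩
  I₂ ⊕ (+ suc k) ⊙ N ⊕ (+ k) ⊙ O₂          ≡⟨ cong (I₂ ⊕ (+ suc k) ⊙ N ⊕_) (⊙-O₂ (+ k)) ⟩
  I₂ ⊕ (+ suc k) ⊙ N ⊕ O₂                  ≡⟨ ⊕-identityʳ (I₂ ⊕ (+ suc k) ⊙ N) ⟩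
  I₂ ⊕ (+ suc k) ⊙ N                       ∎
  where
  open ≡-Reasoning
  N·N≡O₂ : N · N ≡ O₂
  N·N≡O₂ = trans (traceless-square N tr≡0) (cong (λ δ → (- δ) ⊙ I₂) det≡0)

unipotent-torsion : ∀ A → EigOneMult2 A → Torsion A → A ≡ I₂
unipotent-torsion A@(mat a b c d) (tr≡2 , det≡1) (n , Aⁿ⁺¹≡I₂) = begin
  A          ≡⟨ A≡I₂⊕N ⟩
  I₂ ⊕ N     ≡⟨ cong (I₂ ⊕_) ([1+n]⊙X≡O₂⇒X≡O₂ n N (⊕-cancelˡ I₂ _ _ I₂⊕[1+n]N≡I₂⊕O₂)) ⟩
  I₂ ⊕ O₂    ∎
  where
  open ≡-Reasoning
  N : M2
  N = mat (a - 1ℤ) b c (d - 1ℤ)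
  A≡I₂⊕N : A ≡ I₂ ⊕ N
  A≡I₂⊕N = mat-cong (shift a) (sym (ℤ.+-identityˡ b)) (sym (ℤ.+-identityˡ c)) (shift d)
    where
    shift : ∀ x → x ≡ 1ℤ + (x - 1ℤ)
    shift = solve-∀
  trN≡0 : tr N ≡ 0ℤ
  trN≡0 = trans (trace a d) (cong (_- + 2) tr≡2)
    where
    trace : ∀ a d → (a - 1ℤ) + (d - 1ℤ) ≡ (a + d) - + 2
    trace = solve-∀
  detN≡0 : det N ≡ 0ℤ
  detN≡0 = trans (determinant a b c d) (cong₂ (λ δ τ → δ - τ + 1ℤ) det≡1 tr≡2)
    where
    determinant : ∀ a b c d → (a - 1ℤ) * (d - 1ℤ) - b * c ≡ (a * d - b * c) - (a + d) + 1ℤ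
    determinant = solve-∀
  I₂⊕[1+n]N≡I₂⊕O₂ : I₂ ⊕ (+ suc n) ⊙ N ≡ I₂ ⊕ O₂
  I₂⊕[1+n]N≡I₂⊕O₂ = begin
    I₂ ⊕ (+ suc n) ⊙ N   ≡⟨ unipotent-power N trN≡0 detN≡0 (suc n) ⟨
    (I₂ ⊕ N) ^ suc n     ≡⟨ cong (_^ suc n) A≡I₂⊕N ⟨
    A ^ suc n            ≡⟨ Aⁿ⁺¹≡I₂ ⟩
    I₂                   ∎

module LastRow (p : ℕ) where

  open Congruence (+ p)

  record SameLastRow (X Y : M2) : Set where
    constructor sameLastRow
    field
      c≈ : c X ≈ c Y
      d≈ : d X ≈ d Y

  sameLastRow-refl : ∀ {X} → SameLastRow X X
  sameLastRow-refl = sameLastRow ≈-refl ≈-refl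

  sameLastRow-trans : ∀ {X Y Z} → SameLastRow X Y → SameLastRow Y Z → SameLastRow X Z
  sameLastRow-trans (sameLastRow c₁ d₁) (sameLastRow c₂ d₂) = sameLastRow (≈-trans c₁ c₂) (≈-trans d₁ d₂)

  sameLastRow-·ʳ : ∀ {X Y} Z → SameLastRow X Y → SameLastRow (X · Z) (Y · Z)
  sameLastRow-·ʳ Z (sameLastRow c≈ d≈) =
    sameLastRow (+-cong (*-cong c≈ ≈-refl) (*-cong d≈ ≈-refl))
                (+-cong (*-cong c≈ ≈-refl) (*-cong d≈ ≈-refl))

  InΓ⇒sameLastRow-I₂ : ∀ γ → InΓ p γ → SameLastRow γ I₂
  InΓ⇒sameLastRow-I₂ γ (_ , p∣c , p∣d-1) = sameLastRow (∣⇒≈0 (∣ᵤ⇒∣ p∣c)) (congruent (∣ᵤ⇒∣ p∣d-1))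

  sameLastRow-I₂⇒InΓ : ∀ γ → InGL γ → SameLastRow γ I₂ → InΓ p γ
  sameLastRow-I₂⇒InΓ γ gγ (sameLastRow c≈0 (congruent p∣d-1)) = gγ , ∣⇒∣ᵤ (≈0⇒∣ c≈0) , ∣⇒∣ᵤ p∣d-1

  Γ-preserves-lastRow : ∀ γ X → InΓ p γ → SameLastRow (γ · X) X
  Γ-preserves-lastRow γ X γ∈Γ =
    subst (SameLastRow (γ · X)) (·-identityˡ X) (sameLastRow-·ʳ X (InΓ⇒sameLastRow-I₂ γ γ∈Γ))

  sameLastRow⇒Γ-quotient : ∀ X R → InGL X → InGL R → SameLastRow X R → InΓ p (X · inv R)
  sameLastRow⇒Γ-quotient X R gX gR X∼R =
    sameLastRow-I₂⇒InΓ (X · inv R) (InGL-· X (inv R) gX (InGL-inv R gR))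
      (subst (SameLastRow (X · inv R)) (inv-inverseʳ R gR) (sameLastRow-·ʳ (inv R) X∼R))

  InN⇒lastRow-fixed : ∀ A X → InN p A X → SameLastRow (X · A) X
  InN⇒lastRow-fixed A X (gX , XAX⁻¹∈Γ) =
    subst (λ Y → SameLastRow Y X) (y·x⁻¹·x≡y X gX (X · A))
      (Γ-preserves-lastRow (X · A · inv X) X XAX⁻¹∈Γ)

  lastRow-fixed⇒InN : ∀ A X → InGL A → InGL X → SameLastRow (X · A) X → InN p A X
  lastRow-fixed⇒InN A X gA gX XA∼X =
    gX , sameLastRow-I₂⇒InΓ (X · A · inv X) (InGL-· (X · A) (inv X) (InGL-· X A gX gA) (InGL-inv X gX))
           (subst (SameLastRow (X · A · inv X)) (inv-inverseʳ X gX) (sameLastRow-·ʳ (inv X) XA∼X))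

  p∣c⇒lastRow-fixed : ∀ A X → InΓ p A → c X ≈ 0ℤ → SameLastRow (X · A) X
  p∣c⇒lastRow-fixed A X A∈Γ cX≈0 = sameLastRow
    (begin
      c X * a A + d X * c A   ≈⟨ +-cong (*-cong cX≈0 (≈-refl {a A})) (*-cong (≈-refl {d X}) cA≈0) ⟩
      0ℤ + d X * 0ℤ           ≡⟨ vanish (d X) ⟩
      0ℤ                      ≈⟨ ≈-sym cX≈0 ⟩
      c X                     ∎)
    (begin
      c X * b A + d X * d A   ≈⟨ +-cong (*-cong cX≈0 (≈-refl {b A})) (*-cong (≈-refl {d X}) dA≈1) ⟩
      0ℤ + d X * 1ℤ           ≡⟨ keep (d X) ⟩
      d X                     ∎)
    where
    open ≈-Reasoning
    open SameLastRow (InΓ⇒sameLastRow-I₂ A A∈Γ) renaming (c≈ to cA≈0; d≈ to dA≈1)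
    vanish : ∀ x → 0ℤ + x * 0ℤ ≡ 0ℤ
    vanish = solve-∀
    keep : ∀ x → 0ℤ + x * 1ℤ ≡ x
    keep = solve-∀

  lastRow-fixed⇒p∣c : ∀ h → + p ≡ 1ℤ + + 2 * + h → ∀ A X → InΓ p A → IsReflection A →
    SameLastRow (X · A) X → c X ≈ 0ℤ
  lastRow-fixed⇒p∣c h p≡1+2h A X A∈Γ (tr≡0 , _) (sameLastRow XA≈X _) = ≈-neg⇒≈0 h p≡1+2h (begin
    c X                         ≈⟨ ≈-sym XA≈X ⟩
    c X * a A + d X * c A       ≈⟨ +-cong (*-cong (≈-refl {c X}) aA≈-1) (*-cong (≈-refl {d X}) cA≈0) ⟩
    c X * -1ℤ + d X * 0ℤ        ≡⟨ negate (c X) (d X) ⟩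
    - c X                       ∎)
    where
    open ≈-Reasoning
    open SameLastRow (InΓ⇒sameLastRow-I₂ A A∈Γ) renaming (c≈ to cA≈0; d≈ to dA≈1)
    aA≈-1 : a A ≈ -1ℤ
    aA≈-1 = subst (_≈ -1ℤ) (sym (a+d≡0⇒d≡-a (d A) (a A) (trans (ℤ.+-comm (d A) (a A)) tr≡0)))
                  (neg-cong dA≈1)
    negate : ∀ x y → x * -1ℤ + y * 0ℤ ≡ - x
    negate = solve-∀

coprime⇒last-row-completion : ∀ {y p} → Coprime y p → Σ M2 λ R → InGL R × c R ≡ + p × d R ≡ + y
coprime⇒last-row-completion {y} {p} y⊥p with coprime-Bézout y⊥p
... | Bézout.+- x z 1+zp≡xy = mat (+ x) (+ z) (+ p) (+ y) , inj₁ (begin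
  + x * + y - + z * + p          ≡⟨ cong₂ _-_ (ℤ.pos-* x y) (ℤ.pos-* z p) ⟨
  + (x ℕ.* y) - + (z ℕ.* p)      ≡⟨ cong (λ n → + n - + (z ℕ.* p)) 1+zp≡xy ⟨
  1ℤ + + (z ℕ.* p) - + (z ℕ.* p) ≡⟨ cancel (+ (z ℕ.* p)) ⟩
  1ℤ                             ∎) , refl , refl
  where
  open ≡-Reasoning
  cancel : ∀ w → 1ℤ + w - w ≡ 1ℤ
  cancel = solve-∀
... | Bézout.-+ x z 1+xy≡zp = mat (+ x) (+ z) (+ p) (+ y) , inj₂ (begin
  + x * + y - + z * + p          ≡⟨ cong₂ _-_ (ℤ.pos-* x y) (ℤ.pos-* z p) ⟨
  + (x ℕ.* y) - + (z ℕ.* p)      ≡⟨ cong (λ n → + (x ℕ.* y) - + n) 1+xy≡zp ⟨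
  + (x ℕ.* y) - (1ℤ + + (x ℕ.* y)) ≡⟨ cancel (+ (x ℕ.* y)) ⟩
  -1ℤ                            ∎) , refl , refl
  where
  open ≡-Reasoning
  cancel : ∀ w → w - (1ℤ + w) ≡ -1ℤ
  cancel = solve-∀

odd-prime : ∀ {p} → Prime p → 5 ℕ.≤ p → p ≡ suc (2 ℕ.* ((p ∸ 1) / 2))
odd-prime {p} p-prime 5≤p with p % 2 | m%n<n p 2 | m≡m%n+[m/n]*n p 2
... | 0 | _ | p≡[p/2]*2 with prime⇒irreducible p-prime (ℕ.divides (p / 2) p≡[p/2]*2)
...   | inj₁ ()
...   | inj₂ refl with 5≤p
...     | s≤s (s≤s ())
odd-prime {p} p-prime 5≤p | 1 | _ | p≡1+[p/2]*2 = trans p≡1+[p/2]*2 (cong suc (begin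
  p / 2 ℕ.* 2                ≡⟨ ℕ.*-comm (p / 2) 2 ⟩
  2 ℕ.* (p / 2)              ≡⟨ cong (2 ℕ.*_) (m*n/n≡m (p / 2) 2) ⟨
  2 ℕ.* ((p / 2 ℕ.* 2) / 2)  ≡⟨ cong (λ n → 2 ℕ.* ((n ∸ 1) / 2)) p≡1+[p/2]*2 ⟨
  2 ℕ.* ((p ∸ 1) / 2)        ∎))
  where open ≡-Reasoning
odd-prime {p} p-prime 5≤p | suc (suc _) | s≤s (s≤s ()) | _

module DoubleCosets (p h : ℕ) (p-prime : Prime p) (p≡1+2h : p ≡ suc (2 ℕ.* h))
                    (A : M2) (A∈Γ : InΓ p A) (isRefl : IsReflection A) where

  open Congruence (+ p)
  open LastRow p

  private instance
    p≢0 : ℕ.NonZero p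
    p≢0 = prime⇒nonZero p-prime

  p≡1+h+h : p ≡ suc (h ℕ.+ h)
  p≡1+h+h = trans p≡1+2h (cong (λ n → suc (h ℕ.+ n)) (ℕ.+-identityʳ h))

  h+h<p : h ℕ.+ h ℕ.< p
  h+h<p = ℕ.≤-reflexive (sym p≡1+h+h)

  InN⇒c≈0 : ∀ X → InN p A X → c X ≈ 0ℤ
  InN⇒c≈0 X X∈N = lastRow-fixed⇒p∣c h +p≡1+2h A X A∈Γ isRefl (InN⇒lastRow-fixed A X X∈N)
    where
    +p≡1+2h : + p ≡ 1ℤ + + 2 * + h
    +p≡1+2h = trans (cong +_ p≡1+2h) (cong (_+_ 1ℤ) (ℤ.pos-* 2 h))

  c≈0⇒InN : ∀ X → InGL X → c X ≈ 0ℤ → InN p A X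
  c≈0⇒InN X gX cX≈0 = lastRow-fixed⇒InN A X (proj₁ A∈Γ) gX (p∣c⇒lastRow-fixed A X A∈Γ cX≈0)

  DCRel⇒d≈±d : ∀ X Y → InN p A X → DCRel p A X Y → Σ ℤ λ ε → IsUnit ε × d Y ≈ ε * d X
  DCRel⇒d≈±d X .(γ · X · C) X∈N (γ , C , γ∈Γ , C∈C , refl) =
    classify (centralizer-of-reflection A C isRefl C∈C)
    where
    open ≈-Reasoning
    scaled : ∀ ε E → C ≡ ε ⊙ E → SameLastRow (X · E) X → d (γ · X · C) ≈ ε * d X
    scaled ε E C≡εE XE∼X = begin
      d (γ · X · C)               ≡⟨ cong (λ M → d (γ · X · M)) C≡εE ⟩
      d (γ · X · (ε ⊙ E))         ≡⟨ cong d (·-⊙ʳ ε (γ · X) E) ⟩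
      ε * d (γ · X · E)           ≡⟨ cong (λ M → ε * d M) (·-assoc γ X E) ⟩
      ε * d (γ · (X · E))         ≈⟨ *-cong (≈-refl {ε}) (SameLastRow.d≈ γXE∼X) ⟩
      ε * d X                     ∎
      where
      γXE∼X : SameLastRow (γ · (X · E)) X
      γXE∼X = sameLastRow-trans (Γ-preserves-lastRow γ (X · E) γ∈Γ) XE∼X
    classify : Σ ℤ (λ ε → IsUnit ε × (C ≡ ε ⊙ I₂ ⊎ C ≡ ε ⊙ A)) →
      Σ ℤ λ ε → IsUnit ε × d (γ · X · C) ≈ ε * d X
    classify (ε , uε , inj₁ C≡εI₂) =
      ε , uε , scaled ε I₂ C≡εI₂ (subst (λ M → SameLastRow M X) (sym (·-identityʳ X)) sameLastRow-refl)
    classify (ε , uε , inj₂ C≡εA) = ε , uε , scaled ε A C≡εA (InN⇒lastRow-fixed A X X∈N)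

  small-multiple≡0 : ∀ {x} → x ≈ 0ℤ → ∣ x ∣ ℕ.< p → x ≡ 0ℤ
  small-multiple≡0 {x} x≈0 ∣x∣<p =
    ℤ.∣i∣≡0⇒i≡0 (trans (sym (m<n⇒m%n≡m ∣x∣<p)) (ℕ.n∣m⇒m%n≡0 ∣ x ∣ p (∣⇒∣ᵤ (≈0⇒∣ x≈0))))

  height : Fin h → ℕ
  height i = suc (toℕ i)

  height-injective : ∀ i j → + height i ≈ + height j → i ≡ j
  height-injective i j (congruent p∣hi-hj) =
    toℕ-injective (ℕ.suc-injective (ℤ.+-injective
      (ℤ.i-j≡0⇒i≡j _ _ (small-multiple≡0 (∣⇒≈0 p∣hi-hj) bound))))
    where
    bound : ∣ + height i - + height j ∣ ℕ.< p
    bound = ℕ.≤-<-trans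
      (subst (ℕ._≤ height i ℕ.⊔ height j) (cong ∣_∣ (sym (ℤ.m-n≡m⊖n (height i) (height j))))
             (ℤ.∣m⊝n∣≤m⊔n (height i) (height j)))
      (ℕ.≤-<-trans (ℕ.⊔-lub (toℕ<n i) (toℕ<n j)) (ℕ.≤-<-trans (ℕ.m≤m+n h h) h+h<p))

  height-not-opposite : ∀ i j → ¬ (+ height i ≈ - + height j)
  height-not-opposite i j (congruent p∣hi+hj) =
    positive (small-multiple≡0 (∣⇒≈0 (subst (+ p ∣_) sum p∣hi+hj)) bound)
    where
    sum : + height i - - + height j ≡ + (height i ℕ.+ height j)
    sum = trans (cong (_+_ (+ height i)) (ℤ.neg-involutive (+ height j)))
                (sym (ℤ.pos-+ (height i) (height j)))
    bound : height i ℕ.+ height j ℕ.< p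
    bound = ℕ.≤-<-trans (ℕ.+-mono-≤ (toℕ<n i) (toℕ<n j)) h+h<p
    positive : ¬ (+ (height i ℕ.+ height j) ≡ 0ℤ)
    positive ()

  representative-exists : ∀ i → Σ M2 λ R → InGL R × c R ≡ + p × d R ≡ + height i
  representative-exists i =
    coprime⇒last-row-completion (Coprime.sym (prime⇒coprime p-prime (ℕ.≤-<-trans (toℕ<n i) h<p)))
    where
    h<p : h ℕ.< p
    h<p = ℕ.≤-<-trans (ℕ.m≤m+n h h) h+h<p

  representative : Fin h → M2
  representative i = proj₁ (representative-exists i)

  representative-InGL : ∀ i → InGL (representative i)
  representative-InGL i = proj₁ (proj₂ (representative-exists i))

  representative-c : ∀ i → c (representative i) ≡ + p
  representative-c i = proj₁ (proj₂ (proj₂ (representative-exists i)))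

  representative-d : ∀ i → d (representative i) ≡ + height i
  representative-d i = proj₂ (proj₂ (proj₂ (representative-exists i)))

  representative∈N : ∀ i → InN p A (representative i)
  representative∈N i =
    c≈0⇒InN (representative i) (representative-InGL i) (subst (_≈ 0ℤ) (sym (representative-c i)) n≈0)

  representatives-distinct : ∀ i j → DCRel p A (representative i) (representative j) → i ≡ j
  representatives-distinct i j Rj∈ΓRiC =
    sign (DCRel⇒d≈±d (representative i) (representative j) (representative∈N i) Rj∈ΓRiC)
    where
    sign : Σ ℤ (λ ε → IsUnit ε × d (representative j) ≈ ε * d (representative i)) → i ≡ j
    sign (ε , inj₁ refl , hj≈hi) = sym (height-injective j i
      (subst₂ _≈_ (representative-d j) (trans (ℤ.*-identityˡ _) (representative-d i)) hj≈hi))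
    sign (ε , inj₂ refl , hj≈-hi) =
      contradiction
        (subst₂ _≈_ (representative-d j) (trans (ℤ.-1*i≡-i _) (cong -_ (representative-d i))) hj≈-hi)
        (height-not-opposite j i)

  height-surjective : ∀ y → 0 ℕ.< y → y ℕ.≤ h → Σ (Fin h) λ i → height i ≡ y
  height-surjective (suc y) _ y<h = fromℕ< y<h , cong suc (toℕ-fromℕ< y<h)

  height-or-complement : ∀ r → 0 ℕ.< r → r ℕ.< p → Σ (Fin h) λ i → height i ≡ r ⊎ r ℕ.+ height i ≡ p
  height-or-complement r 0<r r<p with r ℕ.≤? h
  ... | yes r≤h = map₂ inj₁ (height-surjective r 0<r r≤h)
  ... | no r≰h = map₂ (λ hi≡p∸r → inj₂ (trans (cong (r ℕ.+_) hi≡p∸r) (ℕ.m+[n∸m]≡n (ℕ.<⇒≤ r<p))))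
                      (height-surjective (p ∸ r) (ℕ.m<n⇒0<n∸m r<p) (ℕ.m≤n+o⇒m∸n≤o p r p≤r+h))
    where
    p≤r+h : p ℕ.≤ r ℕ.+ h
    p≤r+h = subst (ℕ._≤ r ℕ.+ h) (sym p≡1+h+h) (ℕ.+-monoˡ-≤ h (ℕ.≰⇒> r≰h))

  ≉0⇒≈±height : ∀ x → ¬ (x ≈ 0ℤ) → Σ (Fin h) λ i → Σ ℤ λ ε → IsUnit ε × x ≈ ε * + height i
  ≉0⇒≈±height x x≉0 = reduce (x %ℕ p) x≈r (n%ℕd<d x p)
    where
    x≈r : x ≈ + (x %ℕ p)
    x≈r = congruent (divides (x /ℕ p)
      (trans (cong (_- + (x %ℕ p)) (a≡a%ℕn+[a/ℕn]*n x p)) (cancel (+ (x %ℕ p)) (x /ℕ p * + p))))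
      where
      cancel : ∀ r m → (r + m) - r ≡ m
      cancel = solve-∀
    reduce : ∀ r → x ≈ + r → r ℕ.< p → Σ (Fin h) λ i → Σ ℤ λ ε → IsUnit ε × x ≈ ε * + height i
    reduce zero x≈0 _ = contradiction x≈0 x≉0
    reduce r@(suc _) x≈r r<p with height-or-complement r (s≤s z≤n) r<p
    ... | i , inj₁ hi≡r =
      i , 1ℤ , inj₁ refl , subst (x ≈_) (trans (cong +_ (sym hi≡r)) (sym (ℤ.*-identityˡ _))) x≈r
    ... | i , inj₂ r+hi≡p = i , -1ℤ , inj₂ refl , ≈-trans x≈r (congruent (subst (+ p ∣_) p≡r+hi ∣-refl))
      where
      open ≡-Reasoning
      p≡r+hi : + p ≡ + r - -1ℤ * + height i
      p≡r+hi = begin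
        + p                          ≡⟨ cong +_ r+hi≡p ⟨
        + (r ℕ.+ height i)           ≡⟨ ℤ.pos-+ r (height i) ⟩
        + r + + height i             ≡⟨ cong (_+_ (+ r)) (ℤ.neg-involutive (+ height i)) ⟨
        + r - - + height i           ≡⟨ cong (λ y → + r - y) (ℤ.-1*i≡-i (+ height i)) ⟨
        + r - -1ℤ * + height i       ∎

  unit≉0 : ∀ {ε} → IsUnit ε → ¬ (ε ≈ 0ℤ)
  unit≉0 uε ε≈0 =
    ℕ.nonTrivial⇒≢1 {{prime⇒nonTrivial p-prime}}
      (ℕ.∣1⇒≡1 (subst (p ℕ.∣_) (isUnit⇒∣∣≡1 uε) (∣⇒∣ᵤ (≈0⇒∣ ε≈0))))

  lastRow≈0⇒det≈0 : ∀ X → c X ≈ 0ℤ → d X ≈ 0ℤ → det X ≈ 0ℤ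
  lastRow≈0⇒det≈0 X cX≈0 dX≈0 = begin
    a X * d X - b X * c X     ≈⟨ +-cong (*-cong (≈-refl {a X}) dX≈0) (neg-cong (*-cong (≈-refl {b X}) cX≈0)) ⟩
    a X * 0ℤ - b X * 0ℤ       ≡⟨ vanish (a X) (b X) ⟩
    0ℤ                        ∎
    where
    open ≈-Reasoning
    vanish : ∀ x y → x * 0ℤ - y * 0ℤ ≡ 0ℤ
    vanish = solve-∀

  representatives-cover : ∀ X → InN p A X → ∃ λ i → DCRel p A (representative i) X
  representatives-cover X X∈N@(gX , _) = from-residue (≉0⇒≈±height (d X) dX≉0)
    where
    cX≈0 : c X ≈ 0ℤ
    cX≈0 = InN⇒c≈0 X X∈N
    dX≉0 : ¬ (d X ≈ 0ℤ)
    dX≉0 dX≈0 = unit≉0 gX (lastRow≈0⇒det≈0 X cX≈0 dX≈0)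
    from-residue : (Σ (Fin h) λ i → Σ ℤ λ ε → IsUnit ε × d X ≈ ε * + height i) →
      ∃ λ i → DCRel p A (representative i) X
    from-residue (i , ε , uε , dX≈εhi) =
      i , X · C · inv R , C , sameLastRow⇒Γ-quotient (X · C) R gXC gR XC∼R , unit-scalar∈C A uε , X≡γRC
      where
      R C : M2
      R = representative i
      C = ε ⊙ I₂
      gR : InGL R
      gR = representative-InGL i
      gXC : InGL (X · C)
      gXC = InGL-· X C gX (InGL-unit-scalar uε)
      XC∼R : SameLastRow (X · C) R
      XC∼R = subst (λ M → SameLastRow M R) (sym (·-⊙I₂ ε X)) (sameLastRow (begin
        ε * c X                ≈⟨ *-cong (≈-refl {ε}) cX≈0 ⟩
        ε * 0ℤ                 ≡⟨ ℤ.*-zeroʳ ε ⟩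
        0ℤ                     ≈⟨ ≈-sym n≈0 ⟩
        + p                    ≡⟨ representative-c i ⟨
        c R                    ∎) (begin
        ε * d X                ≈⟨ *-cong (≈-refl {ε}) dX≈εhi ⟩
        ε * (ε * + height i)   ≡⟨ isUnit⇒*-involutive uε (+ height i) ⟩
        + height i             ≡⟨ representative-d i ⟨
        d R                    ∎))
        where open ≈-Reasoning
      X≡γRC : X ≡ X · C · inv R · R · C
      X≡γRC = begin
        X                      ≡⟨ ·-identityʳ X ⟨
        X · I₂                 ≡⟨ cong (X ·_) (unit-scalar-involutive uε) ⟨
        X · (C · C)            ≡⟨ ·-assoc X C C ⟨
        X · C · C              ≡⟨ cong (_· C) (y·x⁻¹·x≡y R gR (X · C)) ⟨
        X · C · inv R · R · C  ∎
        where open ≡-Reasoning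

  reflection-double-cosets : NumDoubleCosets p A h
  reflection-double-cosets =
    representative , representative∈N , representatives-distinct , representatives-cover

identity-double-coset : ∀ p → NumDoubleCosets p I₂ 1
identity-double-coset p = (λ _ → I₂) , (λ _ → inj₁ refl , I₂∈Γ) , unique , cover
  where
  I₂∈Γ : InΓ p I₂
  I₂∈Γ = inj₁ refl , p ℕ.∣0 , p ℕ.∣0
  unique : (i j : Fin 1) → DCRel p I₂ I₂ I₂ → i ≡ j
  unique Fin.zero Fin.zero _ = refl
  cover : ∀ X → InN p I₂ X → ∃ λ i → DCRel p I₂ I₂ X
  cover X (gX , _) =
    Fin.zero , I₂ , X , I₂∈Γ , (gX , trans (cong (_· inv X) (·-identityʳ X)) (inv-inverseʳ X gX)) ,
    sym (·-identityˡ X)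

mainTheorem3 : (p : ℕ) → Prime p → 5 ≤ p → (A : M2) → InΓ p A → Torsion A →
    (EigOneMult1 A → NumDoubleCosets p A ((p ∸ 1) / 2))
    × (EigOneMult2 A → NumDoubleCosets p A 1)
mainTheorem3 p p-prime 5≤p A A∈Γ A-torsion = simple-case , double-case
  where
  simple-case : EigOneMult1 A → NumDoubleCosets p A ((p ∸ 1) / 2)
  simple-case simple =
    DoubleCosets.reflection-double-cosets p ((p ∸ 1) / 2) p-prime (odd-prime p-prime 5≤p) A A∈Γ
      (simple-eigenvalue-one⇒reflection A (proj₁ A∈Γ) simple)
  double-case : EigOneMult2 A → NumDoubleCosets p A 1
  double-case double =
    subst (λ B → NumDoubleCosets p B 1) (sym (unipotent-torsion A double A-torsion)) (identity-double-coset p)
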